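{- Let $m,j,k$ be positive integers. Suppose that the outcome class of $G_{m,j}$ is $H$ and that the outcome class of $G_{m,k}$ is $H$ or $2$. Then there exists $N_0$ such that for every integer $N\ge N_0$, the outcome class of $G_{m,N\gcd(j,k)}$ is $H$.
   Context: Domineering is a two-player game played on a set of squares of a rectangular grid. The players alternate placing dominoes, each covering two adjacent unoccupied squares; the player Vertical must place dominoes covering two vertically adjacent squares and the player Horizontal must place dominoes covering two horizontally adjacent squares. A player with no legal move on her turn loses. $G_{m,n}$ denotes the Domineering position consisting of the full $m\times n$ rectangular board with vertical dimension $m$ (number of rows) and horizontal dimension $n$ (number of columns). The outcome class of a position under optimal play is: $V$ if Vertical wins no matter who moves first; $H$ if Horizontal wins no matter who moves first; $1$ if the player who moves first wins (whichever player that is); $2$ if the player who moves second wins. -}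

module Defs where

open import Data.Nat using (ℕ; zero; suc; _+_; _<_)
open import Data.Fin using (Fin; toℕ)
open import Data.Bool using (Bool; true; false)
open import Data.Product using (_×_; Σ; _,_)
open import Data.Sum using (_⊎_)
open import Relation.Binary.PropositionalEquality using (_≡_; _≢_)
open import Relation.Nullary using (¬_)

-- A Domineering position on an m × n board (m rows, n columns):
-- free r c ≡ true  means the square in row r, column c is unoccupied.
-- Positions that are subsets of the full board are represented by marking
-- the other squares occupied.
Board : ℕ → ℕ → Set
Board m n = Fin m → Fin n → Bool

data Player : Set where
  Vertical Horizontal : Player

opponent : Player → Player
opponent Vertical   = Horizontal
opponent Horizontal = Vertical

Adjacent : ∀ {m n} → Player → (Fin m × Fin n) → (Fin m × Fin n) → Set
Adjacent Vertical   (r , c) (r' , c') = (suc (toℕ r) ≡ toℕ r') × (c ≡ c')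
Adjacent Horizontal (r , c) (r' , c') = (r ≡ r') × (suc (toℕ c) ≡ toℕ c')

record Move {m n : ℕ} (p : Player) (b b' : Board m n) : Set where
  field
    x y      : Fin m × Fin n
    adj      : Adjacent p x y
    freeX    : b (Data.Product.proj₁ x) (Data.Product.proj₂ x) ≡ true
    freeY    : b (Data.Product.proj₁ y) (Data.Product.proj₂ y) ≡ true
    coverX   : b' (Data.Product.proj₁ x) (Data.Product.proj₂ x) ≡ false
    coverY   : b' (Data.Product.proj₁ y) (Data.Product.proj₂ y) ≡ false
    unchanged : ∀ r c → (r , c) ≢ x → (r , c) ≢ y → b' r c ≡ b r c

-- Under optimal play (Domineering is a finite game, so these inductive
-- definitions capture the usual notion):
--   WinsMovingFirst p b : player p, moving first from b, has a winning strategy;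
--   LosesMovingFirst p b : every move of p from b leads to a position where
--     the opponent, now moving first, wins (in particular if p has no move).
mutual
  data WinsMovingFirst {m n : ℕ} (p : Player) (b : Board m n) : Set where
    win : (b' : Board m n) → Move p b b' →
          LosesMovingFirst (opponent p) b' → WinsMovingFirst p b

  data LosesMovingFirst {m n : ℕ} (p : Player) (b : Board m n) : Set where
    lose : ((b' : Board m n) → Move p b b' →
            WinsMovingFirst (opponent p) b') → LosesMovingFirst p b

data OutcomeClass : Set where
  V H 𝟏 𝟐 : OutcomeClass

-- "The second player wins when p moves first" is LosesMovingFirst p b.
HasOutcome : ∀ {m n} → Board m n → OutcomeClass → Set
HasOutcome b V = WinsMovingFirst Vertical b × LosesMovingFirst Horizontal b
HasOutcome b H = WinsMovingFirst Horizontal b × LosesMovingFirst Vertical b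
HasOutcome b 𝟏 = WinsMovingFirst Vertical b × WinsMovingFirst Horizontal b
HasOutcome b 𝟐 = LosesMovingFirst Vertical b × LosesMovingFirst Horizontal b

G : (m n : ℕ) → Board m n
G m n _ _ = true

-- Placing two boards side by side gives Horizontal extra moves across the seam but gives
-- Vertical nothing new, so "Vertical loses moving first" is preserved under juxtaposition,
-- and so is "Horizontal wins moving first" as long as one part is a first-player loss for
-- Vertical.  Hence G_{m,n} is in H whenever n = j + A j + B k.  By Bézout, every large
-- multiple of gcd(j, k) is a non-negative combination of j and k, and so is N gcd(j, k) − j.
module Submission where

open import Defs
open import Data.Nat using (ℕ; zero; suc; _+_; _*_; _∸_; _≤_; NonZero)
open import Data.Nat.Properties
  using (+-comm; +-suc; *-assoc; *-distribʳ-+; *-monoˡ-≤; <⇒≤; ≤-trans; m≤n⇒∃[o]m+o≡n;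
         m+n≤o⇒m≤o∸n; m+n≤o⇒n≤o; m+[n∸m]≡n; m*n≢0⇒m≢0)
open import Data.Nat.DivMod using (_%_; _/_; m≡m%n+[m/n]*n; m%n<n; m*n/n≡m; /-monoˡ-≤)
open import Data.Nat.Divisibility using (_∣_; divides)
open import Data.Nat.GCD using (gcd; gcd[m,n]∣m; gcd[m,n]∣n; gcd-GCD; module Bézout)
open import Data.Nat.Tactic.RingSolver using (solve-∀)
open import Data.Fin using (Fin; toℕ; _↑ˡ_; _↑ʳ_; splitAt)
open import Data.Fin.Properties
  using (¬Fin0; toℕ-↑ˡ; toℕ-↑ʳ; ↑ˡ-injective; ↑ʳ-injective; splitAt-↑ˡ; splitAt-↑ʳ; splitAt⁻¹-↑ˡ; splitAt⁻¹-↑ʳ)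
open import Data.Product using (_×_; _,_; proj₁; proj₂; ∃; ∃₂)
open import Data.Product.Properties using (,-injective)
open import Data.Sum using (_⊎_; inj₁; inj₂; [_,_]′)
open import Data.Empty using (⊥-elim)
open import Relation.Binary.PropositionalEquality

Representable : ℕ → ℕ → ℕ → Set
Representable j k n = ∃₂ λ A B → n ≡ A * j + B * k

Eventually : (ℕ → Set) → Set
Eventually P = ∃ λ N₀ → ∀ N → N₀ ≤ N → P N

representable-swap : ∀ {j k n} → Representable j k n → Representable k j n
representable-swap {j} {k} (A , B , eq) = B , A , trans eq (+-comm (A * j) (B * k))

-- Write N = r + q k' with r < k'; once q ≥ r y, the Bézout relation trades the r copies of
-- g for r x copies of j.
representable-from-bezout : ∀ {g j k} .{{_ : NonZero k}} → g ∣ k → ∀ x y → g + y * k ≡ x * j →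
  Eventually (λ N → Representable j k (N * g))
representable-from-bezout {g} {j} (divides k' refl) x y bezout = k' * y * k' , λ N large →
  let r = N % k'
      q = N / k'
      k'y≤q : k' * y ≤ q
      k'y≤q = subst (_≤ q) (m*n/n≡m (k' * y) k') (/-monoˡ-≤ k' large)
      ry≤q : r * y ≤ q
      ry≤q = ≤-trans (*-monoˡ-≤ y (<⇒≤ (m%n<n N k'))) k'y≤q
      B , ry+B≡q = m≤n⇒∃[o]m+o≡n ry≤q
  in r * x , B , (begin
    N * g                                 ≡⟨ cong (_* g) (m≡m%n+[m/n]*n N k') ⟩
    (r + q * k') * g                      ≡⟨ cong (λ t → (r + t * k') * g) (sym ry+B≡q) ⟩
    (r + (r * y + B) * k') * g            ≡⟨ regroup r y B k' g ⟩
    r * (g + y * (k' * g)) + B * (k' * g) ≡⟨ cong (λ t → r * t + B * (k' * g)) bezout ⟩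
    r * (x * j) + B * (k' * g)            ≡⟨ cong (_+ B * (k' * g)) (sym (*-assoc r x j)) ⟩
    r * x * j + B * (k' * g)              ∎)
  where
  open ≡-Reasoning
  instance _ = m*n≢0⇒m≢0 k'
  regroup : ∀ r y B k' g → (r + (r * y + B) * k') * g ≡ r * (g + y * (k' * g)) + B * (k' * g)
  regroup = solve-∀

multiples-of-gcd-representable : ∀ j k .{{_ : NonZero j}} .{{_ : NonZero k}} →
  Eventually (λ N → Representable j k (N * gcd j k))
multiples-of-gcd-representable j k with Bézout.identity (gcd-GCD j k)
... | Bézout.+- x y bezout = representable-from-bezout (gcd[m,n]∣n j k) x y bezout
... | Bézout.-+ x y bezout =
  let N₀ , representable = representable-from-bezout (gcd[m,n]∣m j k) y x bezout
  in N₀ , λ N large → representable-swap (representable N large)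

multiples-of-gcd-minus-j-representable : ∀ j k .{{_ : NonZero j}} .{{_ : NonZero k}} →
  Eventually (λ N → ∃ λ n → Representable j k n × N * gcd j k ≡ j + n)
multiples-of-gcd-minus-j-representable j k
  with gcd[m,n]∣m j k | multiples-of-gcd-representable j k
... | divides j' j≡j'g | N₀ , representable = N₀ + j' , λ N large →
  (N ∸ j') * g , representable (N ∸ j') (m+n≤o⇒m≤o∸n N₀ large) , (begin
    N * g                 ≡⟨ cong (_* g) (sym (m+[n∸m]≡n (m+n≤o⇒n≤o N₀ large))) ⟩
    (j' + (N ∸ j')) * g   ≡⟨ *-distribʳ-+ g j' (N ∸ j') ⟩
    j' * g + (N ∸ j') * g ≡⟨ cong (_+ (N ∸ j') * g) (sym j≡j'g) ⟩
    j + (N ∸ j') * g      ∎)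
  where
  open ≡-Reasoning
  g = gcd j k

record ColumnEmbedding (n N : ℕ) : Set where
  field
    embed               : Fin n → Fin N
    injective           : ∀ c d → embed c ≡ embed d → c ≡ d
    preserves-successor : ∀ c d → suc (toℕ c) ≡ toℕ d → suc (toℕ (embed c)) ≡ toℕ (embed d)
    image?              : ∀ c → (∃ λ d → embed d ≡ c) ⊎ (∀ d → embed d ≢ c)

open ColumnEmbedding

column : ∀ {m n p} {b b' : Board m n} → Move p b b' → Fin n
column mv = proj₂ (Move.x mv)

verticalMove-elsewhere : ∀ {m n} {b b' : Board m n} (mv : Move Vertical b b') →
  ∀ r c → c ≢ column mv → b' r c ≡ b r c
verticalMove-elsewhere mv r c c≢ = unchanged r c
  (λ eq → c≢ (proj₂ (,-injective eq)))
  (λ eq → c≢ (trans (proj₂ (,-injective eq)) (sym (proj₂ adj))))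
  where open Move mv

restrict-verticalMove : ∀ {m n N} (e : ColumnEmbedding n N) {z z' : Board m N} {b : Board m n} →
  (∀ r c → z r (embed e c) ≡ b r c) → (mv : Move Vertical z z') →
  ∀ c₀ → embed e c₀ ≡ column mv → Move Vertical b (λ r c → z' r (embed e c))
restrict-verticalMove e {z} {z'} restricts mv c₀ e-c₀≡x = record
  { x         = proj₁ x , c₀
  ; y         = proj₁ y , c₀
  ; adj       = proj₁ adj , refl
  ; freeX     = trans (sym (restricts _ c₀)) (trans (cong (z _) e-c₀≡x) freeX)
  ; freeY     = trans (sym (restricts _ c₀)) (trans (cong (z _) e-c₀≡y) freeY)
  ; coverX    = trans (cong (z' _) e-c₀≡x) coverX
  ; coverY    = trans (cong (z' _) e-c₀≡y) coverY
  ; unchanged = λ r c ≢x ≢y →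
      trans (unchanged r (embed e c) (λ eq → ≢x (pullback e-c₀≡x eq)) (λ eq → ≢y (pullback e-c₀≡y eq)))
            (restricts r c)
  }
  where
  open Move mv
  e-c₀≡y : embed e c₀ ≡ proj₂ y
  e-c₀≡y = trans e-c₀≡x (proj₂ adj)
  pullback : ∀ {r s c d} → embed e c₀ ≡ d → (r , embed e c) ≡ (s , d) → (r , c) ≡ (s , c₀)
  pullback {c = c} e-c₀≡d eq =
    let r≡s , e-c≡d = ,-injective eq
    in cong₂ _,_ r≡s (injective e c c₀ (trans e-c≡d (sym e-c₀≡d)))

extend-horizontalMove : ∀ {m n N} (e : ColumnEmbedding n N) {z z' : Board m N} {b b' : Board m n} →
  (∀ r c → z r (embed e c) ≡ b r c) → (∀ r c → z' r (embed e c) ≡ b' r c) →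
  (∀ r c → (∀ d → embed e d ≢ c) → z' r c ≡ z r c) →
  Move Horizontal b b' → Move Horizontal z z'
extend-horizontalMove {m} {n} {N} e {z} {z'} restricts restricts' outside mv = record
  { x         = embedSquare x
  ; y         = embedSquare y
  ; adj       = proj₁ adj , preserves-successor e _ _ (proj₂ adj)
  ; freeX     = trans (restricts _ _) freeX
  ; freeY     = trans (restricts _ _) freeY
  ; coverX    = trans (restricts' _ _) coverX
  ; coverY    = trans (restricts' _ _) coverY
  ; unchanged = unchanged′
  }
  where
  open Move mv
  embedSquare : Fin m × Fin n → Fin m × Fin N
  embedSquare (r , c) = r , embed e c
  unchanged′ : ∀ r c → (r , c) ≢ embedSquare x → (r , c) ≢ embedSquare y → z' r c ≡ z r c
  unchanged′ r c ≢x ≢y with image? e c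
  ... | inj₂ outside-image = outside r c outside-image
  ... | inj₁ (d , refl) =
    trans (restricts' r d)
          (trans (unchanged r d (λ eq → ≢x (cong embedSquare eq)) (λ eq → ≢y (cong embedSquare eq)))
                 (sym (restricts r d)))

↑ˡ≢↑ʳ : ∀ {a b} (c : Fin a) (d : Fin b) → c ↑ˡ b ≢ a ↑ʳ d
↑ˡ≢↑ʳ {a} {b} c d eq with trans (sym (splitAt-↑ˡ a c b)) (trans (cong (splitAt a) eq) (splitAt-↑ʳ a b d))
... | ()

leftColumns : ∀ a b → ColumnEmbedding a (a + b)
leftColumns a b = record
  { embed               = _↑ˡ b
  ; injective           = ↑ˡ-injective b
  ; preserves-successor = λ c d c+1≡d → trans (cong suc (toℕ-↑ˡ c b)) (trans c+1≡d (sym (toℕ-↑ˡ d b)))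
  ; image?              = image?′
  }
  where
  image?′ : ∀ c → (∃ λ d → d ↑ˡ b ≡ c) ⊎ (∀ d → d ↑ˡ b ≢ c)
  image?′ c with splitAt a c in eq
  ... | inj₁ d = inj₁ (d , splitAt⁻¹-↑ˡ eq)
  ... | inj₂ d = inj₂ λ d' eq' → ↑ˡ≢↑ʳ d' d (trans eq' (sym (splitAt⁻¹-↑ʳ eq)))

rightColumns : ∀ a b → ColumnEmbedding b (a + b)
rightColumns a b = record
  { embed               = a ↑ʳ_
  ; injective           = ↑ʳ-injective a
  ; preserves-successor = λ c d c+1≡d →
      trans (cong suc (toℕ-↑ʳ a c)) (trans (sym (+-suc a (toℕ c))) (trans (cong (a +_) c+1≡d) (sym (toℕ-↑ʳ a d))))
  ; image?              = image?′
  }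
  where
  image?′ : ∀ c → (∃ λ d → a ↑ʳ d ≡ c) ⊎ (∀ d → a ↑ʳ d ≢ c)
  image?′ c with splitAt a c in eq
  ... | inj₂ d = inj₁ (d , splitAt⁻¹-↑ʳ eq)
  ... | inj₁ d = inj₂ λ d' eq' → ↑ˡ≢↑ʳ d d' (trans (splitAt⁻¹-↑ˡ eq) (sym eq'))

_∥_ : ∀ {m a b} → Board m a → Board m b → Board m (a + b)
(x ∥ y) r c = [ x r , y r ]′ (splitAt _ c)

record IsJuxtaposition {m a b} (x : Board m a) (y : Board m b) (z : Board m (a + b)) : Set where
  field
    left  : ∀ r c → z r (c ↑ˡ b) ≡ x r c
    right : ∀ r c → z r (a ↑ʳ c) ≡ y r c

∥-isJuxtaposition : ∀ {m a b} (x : Board m a) (y : Board m b) → IsJuxtaposition x y (x ∥ y)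
∥-isJuxtaposition {a = a} {b} x y = record
  { left  = λ r c → cong [ x r , y r ]′ (splitAt-↑ˡ a c b)
  ; right = λ r c → cong [ x r , y r ]′ (splitAt-↑ʳ a b c)
  }

module _ {m a b : ℕ} where

  mutual
    losesVertical-juxtaposition : ∀ {x y z} → IsJuxtaposition {m} {a} {b} x y z →
      LosesMovingFirst Vertical x → LosesMovingFirst Vertical y → LosesMovingFirst Vertical z
    losesVertical-juxtaposition {x} {y} {z} j (lose respondˣ) (lose respondʸ) =
      lose λ z' mv → respond z' mv (splitAt a (column mv)) refl
      where
      open IsJuxtaposition j
      respond : ∀ z' (mv : Move Vertical z z') → ∀ s → splitAt a (column mv) ≡ s →
                WinsMovingFirst Horizontal z'
      respond z' mv (inj₁ c₀) eq = winsHorizontal-juxtapositionˡ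
        (record { left = λ _ _ → refl
                ; right = λ r c → trans (verticalMove-elsewhere mv r (a ↑ʳ c)
                                          (λ eq' → ↑ˡ≢↑ʳ c₀ c (trans (splitAt⁻¹-↑ˡ eq) (sym eq'))))
                                        (right r c) })
        (respondˣ _ (restrict-verticalMove (leftColumns a b) left mv c₀ (splitAt⁻¹-↑ˡ eq)))
        (lose respondʸ)
      respond z' mv (inj₂ c₀) eq = winsHorizontal-juxtapositionʳ
        (record { right = λ _ _ → refl
                ; left = λ r c → trans (verticalMove-elsewhere mv r (c ↑ˡ b)
                                         (λ eq' → ↑ˡ≢↑ʳ c c₀ (trans eq' (sym (splitAt⁻¹-↑ʳ eq)))))
                                       (left r c) })
        (lose respondˣ)
        (respondʸ _ (restrict-verticalMove (rightColumns a b) right mv c₀ (splitAt⁻¹-↑ʳ eq)))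

    winsHorizontal-juxtapositionˡ : ∀ {x y z} → IsJuxtaposition {m} {a} {b} x y z →
      WinsMovingFirst Horizontal x → LosesMovingFirst Vertical y → WinsMovingFirst Horizontal z
    winsHorizontal-juxtapositionˡ {x} {y} {z} j (win x' mv x'-loses) y-loses =
      win (x' ∥ y) (extend-horizontalMove (leftColumns a b) left left′ outside mv)
        (losesVertical-juxtaposition (∥-isJuxtaposition x' y) x'-loses y-loses)
      where
      open IsJuxtaposition j
      open IsJuxtaposition (∥-isJuxtaposition x' y) using () renaming (left to left′)
      outside : ∀ r c → (∀ d → d ↑ˡ b ≢ c) → (x' ∥ y) r c ≡ z r c
      outside r c notLeft with splitAt a c in eq
      ... | inj₁ d = ⊥-elim (notLeft d (splitAt⁻¹-↑ˡ eq))
      ... | inj₂ d = trans (sym (right r d)) (cong (z r) (splitAt⁻¹-↑ʳ eq))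

    winsHorizontal-juxtapositionʳ : ∀ {x y z} → IsJuxtaposition {m} {a} {b} x y z →
      LosesMovingFirst Vertical x → WinsMovingFirst Horizontal y → WinsMovingFirst Horizontal z
    winsHorizontal-juxtapositionʳ {x} {y} {z} j x-loses (win y' mv y'-loses) =
      win (x ∥ y') (extend-horizontalMove (rightColumns a b) right right′ outside mv)
        (losesVertical-juxtaposition (∥-isJuxtaposition x y') x-loses y'-loses)
      where
      open IsJuxtaposition j
      open IsJuxtaposition (∥-isJuxtaposition x y') using () renaming (right to right′)
      outside : ∀ r c → (∀ d → a ↑ʳ d ≢ c) → (x ∥ y') r c ≡ z r c
      outside r c notRight with splitAt a c in eq
      ... | inj₂ d = ⊥-elim (notRight d (splitAt⁻¹-↑ʳ eq))
      ... | inj₁ d = trans (sym (left r d)) (cong (z r) (splitAt⁻¹-↑ˡ eq))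

G-isJuxtaposition : ∀ m a b → IsJuxtaposition (G m a) (G m b) (G m (a + b))
G-isJuxtaposition m a b = record { left = λ _ _ → refl ; right = λ _ _ → refl }

losesVertical-empty : ∀ m → LosesMovingFirst Vertical (G m 0)
losesVertical-empty m = lose λ _ mv → ⊥-elim (¬Fin0 (column mv))

losesVertical-+ : ∀ {m a b} →
  LosesMovingFirst Vertical (G m a) → LosesMovingFirst Vertical (G m b) →
  LosesMovingFirst Vertical (G m (a + b))
losesVertical-+ {m} {a} {b} = losesVertical-juxtaposition (G-isJuxtaposition m a b)

losesVertical-* : ∀ {m a} → LosesMovingFirst Vertical (G m a) →
  ∀ A → LosesMovingFirst Vertical (G m (A * a))
losesVertical-* {m} a-loses zero    = losesVertical-empty m
losesVertical-* a-loses (suc A) = losesVertical-+ a-loses (losesVertical-* a-loses A)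

losesVertical-representable : ∀ {m j k n} →
  LosesMovingFirst Vertical (G m j) → LosesMovingFirst Vertical (G m k) →
  Representable j k n → LosesMovingFirst Vertical (G m n)
losesVertical-representable j-loses k-loses (A , B , refl) =
  losesVertical-+ (losesVertical-* j-loses A) (losesVertical-* k-loses B)

outcomeH-+ : ∀ {m a b} → HasOutcome (G m a) H → LosesMovingFirst Vertical (G m b) →
  HasOutcome (G m (a + b)) H
outcomeH-+ {m} {a} {b} (a-wins , a-loses) b-loses =
  winsHorizontal-juxtapositionˡ (G-isJuxtaposition m a b) a-wins b-loses ,
  losesVertical-juxtaposition (G-isJuxtaposition m a b) a-loses b-loses

mainTheorem5 : (m j k : ℕ) → .{{_ : NonZero m}} → .{{_ : NonZero j}} → .{{_ : NonZero k}} →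
    HasOutcome (G m j) H → (HasOutcome (G m k) H ⊎ HasOutcome (G m k) 𝟐) →
    ∃ λ N₀ → (N : ℕ) → N₀ ≤ N → HasOutcome (G m (N * gcd j k)) H
mainTheorem5 m j k j-in-H k-in-H-or-𝟐 =
  let N₀ , eventually = multiples-of-gcd-minus-j-representable j k
  in N₀ , λ N large →
    let n , n-representable , N*g≡j+n = eventually N large
    in subst (λ t → HasOutcome (G m t) H) (sym N*g≡j+n)
         (outcomeH-+ j-in-H (losesVertical-representable (proj₂ j-in-H) k-losesVertical n-representable))
  where
  k-losesVertical : LosesMovingFirst Vertical (G m k)
  k-losesVertical = [ proj₂ , proj₁ ]′ k-in-H-or-𝟐
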